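{- Let $G$ be a finite directed multigraph with vertex set $\{1,\dots,n+1\}$ ($n\ge1$) having a global sink at $n+1$, with reduced Laplacian $\Delta$. Let $a$ be a critical configuration and let $b$ be a stable configuration with $b\sim a$. Then $w(a)\ge w(b)$.
   Context: Global sink: out-degree of $n+1$ is $0$ and every vertex has a directed path to $n+1$. $d^+_i$ is the out-degree of $i$, $e_{ij}$ the number of edges from $i$ to $j$. $\Delta$ is the $n\times n$ matrix with $\Delta_{ii}=d^+_i$, $\Delta_{ij}=-e_{ij}$ ($i\ne j$), rows $\Delta_i$. A configuration is $a\in\mathbb{Z}^n$; non-negative if all $a_i\ge0$, stable if $0\le a_i\le d^+_i-1$ for all $i$. Vertex $i$ is active if $a_i\ge d^+_i$; firing $i$ replaces $a$ by $a-\Delta_i$. For non-negative $c$, repeatedly firing active vertices terminates at a unique stable configuration $c^o$. $a\sim b$ means $a-b$ lies in the $\mathbb{Z}$-span of the rows of $\Delta$. The weight is $w(a)=\sum_ia_i$. Let $a_{\max}=(d^+_1-1,\dots,d^+_n-1)$; $a$ is critical if it is stable and $a=(a_{\max}+c)^o$ for some non-negative configuration $c$. -}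

module Defs where

open import Data.Nat as ℕ using (ℕ; zero; suc)
open import Data.Integer as ℤ using (ℤ; +_; _-_; _*_; _≤_)
open import Data.Fin using (Fin; fromℕ; inject₁)
open import Data.Product using (Σ; ∃; _×_; _,_)
open import Relation.Binary.PropositionalEquality using (_≡_; _≢_)
open import Relation.Nullary.Decidable using (⌊_⌋)
open import Data.Fin using (_≟_)
open import Data.Bool using (if_then_else_)

sumℕ : ∀ {m} → (Fin m → ℕ) → ℕ
sumℕ {zero}  f = 0
sumℕ {suc m} f = f Data.Fin.zero ℕ.+ sumℕ (λ i → f (Data.Fin.suc i))

sumℤ : ∀ {m} → (Fin m → ℤ) → ℤ
sumℤ {zero}  f = + 0
sumℤ {suc m} f = f Data.Fin.zero ℤ.+ sumℤ (λ i → f (Data.Fin.suc i))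

-- A finite directed multigraph on vertex set Fin (suc n) (vertices 1..n+1),
-- given by edge multiplicities: e i j = number of edges from i to j.
Multigraph : ℕ → Set
Multigraph n = Fin (suc n) → Fin (suc n) → ℕ

module _ {n : ℕ} (G : Multigraph n) where

  -- the sink vertex n+1 and the non-sink vertices 1..n
  sink : Fin (suc n)
  sink = fromℕ n

  vtx : Fin n → Fin (suc n)
  vtx = inject₁

  outdeg : Fin (suc n) → ℕ
  outdeg i = sumℕ (λ j → G i j)

  data Path : Fin (suc n) → Fin (suc n) → Set where
    here : ∀ {u} → Path u u
    edge : ∀ {u w v} → 0 ℕ.< G u w → Path w v → Path u v

  GlobalSink : Set
  GlobalSink = outdeg sink ≡ 0 × (∀ u → Path u sink)

  Config : Set
  Config = Fin n → ℤ

  d⁺ : Fin n → ℤ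
  d⁺ i = + outdeg (vtx i)

  Δ : Fin n → Fin n → ℤ
  Δ i j = if ⌊ i ≟ j ⌋ then d⁺ i else ℤ.- (+ G (vtx i) (vtx j))

  NonNeg : Config → Set
  NonNeg a = ∀ i → + 0 ≤ a i

  Stable : Config → Set
  Stable a = ∀ i → (+ 0 ≤ a i) × (a i ℤ.< d⁺ i)

  Active : Config → Fin n → Set
  Active a i = d⁺ i ≤ a i

  fire : Config → Fin n → Config
  fire a i j = a j - Δ i j

  data _⟶*_ : Config → Config → Set where
    done : ∀ {a} → a ⟶* a
    step : ∀ {a b} i → Active a i → fire a i ⟶* b → a ⟶* b

  -- c^o = s : s is stable and obtained from c by firing active vertices
  -- (for non-negative c this s exists and is unique)
  StabilizesTo : Config → Config → Set
  StabilizesTo c s = (c ⟶* s) × Stable s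

  _∼_ : Config → Config → Set
  a ∼ b = Σ (Fin n → ℤ) λ k → ∀ j → a j - b j ≡ sumℤ (λ i → k i * Δ i j)

  weight : Config → ℤ
  weight a = sumℤ a

  amax : Config
  amax i = d⁺ i - + 1

  Critical : Config → Set
  Critical a = Stable a × Σ Config (λ c → NonNeg c × StabilizesTo (λ i → amax i ℤ.+ c i) a)

-- A script v : Fin n → ℤ fires every vertex i exactly vᵢ times, ignoring
-- activity; vertex j then loses  lost v j = Σᵢ vᵢ Δᵢⱼ  chips, and we write
-- X ─[ v ]→ b  when  b = X - lost v.  After finite-sum lemmas, the
-- Laplacian module develops:
--   * weight: Σⱼ lost v j = Σᵢ vᵢ ρᵢ with row sums ρᵢ ≥ 0, so non-negative
--     scripts do not increase the weight;
--   * monotonicity of Δ (global sink): lost w ≥ 0 forces w ≥ 0, because the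
--     negative part p of w has lost p ≤ 0, whence no edge leaves the support
--     of p, which therefore cannot reach the sink and is empty;
--   * transport: scripts pull back along firings, and non-negative scripts
--     to a stable configuration push forward along legal firings.
-- For a = (amax + c)°, a script a ─[ -k ]→ b pulls back to X = amax + c; it
-- is non-negative since b ≤ amax ≤ X, and pushes forward to a ─[ w ]→ b, w ≥ 0.
module Submission where

open import Defs
open import Data.Nat using (ℕ; suc)
open import Data.Integer using (_≤_)

import Data.Nat as Nat
import Data.Nat.Properties as NatP
open import Data.Integer using (ℤ; +_; -[1+_]; _+_; _-_; _*_; -_; _<_; +≤+; +<+; 0ℤ; 1ℤ; -1ℤ)
import Data.Integer.Properties as ℤP
open import Data.Integer.Base using (positive; nonNegative)
open import Data.Integer.Tactic.RingSolver using (solve-∀)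
open import Data.Fin using (Fin; zero; suc; _≟_; punchIn)
open import Data.Fin.Properties using (punchInᵢ≢i; fromℕ≢inject₁)
open import Data.Fin.Relation.Unary.Top using (view; ‵fromℕ; ‵inj₁)
open import Data.Product using (∃; _×_; _,_; proj₁; proj₂)
open import Data.Sum using (_⊎_; inj₁; inj₂)
open import Data.Empty using (⊥-elim)
open import Data.Bool using (true; false; if_then_else_)
open import Function using (_∘_)
open import Relation.Nullary using (¬_; yes; no)
open import Relation.Nullary.Decidable using (⌊_⌋)
open import Relation.Binary.PropositionalEquality
open import Algebra.Properties.Semiring.Sum ℤP.+-*-semiring
  using (sum; sum-cong-≗; ∑-distrib-+; ∑-comm; *-distribˡ-sum; sum-replicate-zero;
         sum-init-last; sum-remove)

*-nonneg : ∀ {x y} → 0ℤ ≤ x → 0ℤ ≤ y → 0ℤ ≤ x * y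
*-nonneg {x} {y} 0≤x 0≤y = ℤP.*-monoʳ-≤-nonNeg y {{nonNegative 0≤y}} 0≤x

pos-factor-nonpos : ∀ {x y} → 0ℤ < x → x * y ≤ 0ℤ → y ≤ 0ℤ
pos-factor-nonpos {x} {y} 0<x xy≤0 =
  ℤP.*-cancelˡ-≤-pos y 0ℤ x {{positive 0<x}} (subst (x * y ≤_) (sym (ℤP.*-zeroʳ x)) xy≤0)

not-positive : ∀ {e} → + e ≤ 0ℤ → ¬ (0 Nat.< e)
not-positive (+≤+ e≤0) 0<e = NatP.<⇒≱ 0<e e≤0

sumℤ≡sum : ∀ {m} (f : Fin m → ℤ) → sumℤ f ≡ sum f
sumℤ≡sum {Nat.zero} f = refl
sumℤ≡sum {suc m}    f = cong (λ t → f zero + t) (sumℤ≡sum (f ∘ suc))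

sumℕ≡sum : ∀ {m} (f : Fin m → ℕ) → + sumℕ f ≡ sum (λ i → + f i)
sumℕ≡sum {Nat.zero} f = refl
sumℕ≡sum {suc m}    f = trans (ℤP.pos-+ (f zero) _) (cong (λ t → + f zero + t) (sumℕ≡sum (f ∘ suc)))

sum-neg : ∀ {m} (f : Fin m → ℤ) → sum (λ i → - f i) ≡ - sum f
sum-neg f = begin
  sum (λ i → - f i)      ≡⟨ sum-cong-≗ (λ i → sym (ℤP.-1*i≡-i (f i))) ⟩
  sum (λ i → -1ℤ * f i)  ≡⟨ sym (*-distribˡ-sum -1ℤ f) ⟩
  -1ℤ * sum f            ≡⟨ ℤP.-1*i≡-i (sum f) ⟩
  - sum f                ∎
  where open ≡-Reasoning

sum-sub : ∀ {m} (f g : Fin m → ℤ) → sum (λ i → f i - g i) ≡ sum f - sum g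
sum-sub f g = trans (∑-distrib-+ f (λ i → - g i)) (cong (λ t → sum f + t) (sum-neg g))

sum-mono : ∀ {m} {f g : Fin m → ℤ} → (∀ i → f i ≤ g i) → sum f ≤ sum g
sum-mono {Nat.zero} f≤g = ℤP.≤-refl
sum-mono {suc m}    f≤g = ℤP.+-mono-≤ (f≤g zero) (sum-mono (f≤g ∘ suc))

sum-nonneg : ∀ {m} {f : Fin m → ℤ} → (∀ i → 0ℤ ≤ f i) → 0ℤ ≤ sum f
sum-nonneg {m} {f} 0≤f = subst (_≤ sum f) (sum-replicate-zero m) (sum-mono 0≤f)

term≤sum : ∀ {m} {f : Fin m → ℤ} → (∀ i → 0ℤ ≤ f i) → ∀ i → f i ≤ sum f
term≤sum {suc m} {f} 0≤f i = begin
  f i                                         ≡⟨ ℤP.+-identityʳ (f i) ⟨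
  f i + 0ℤ                                    ≤⟨ ℤP.+-monoʳ-≤ (f i) (sum-nonneg (λ k → 0≤f (punchIn i k))) ⟩
  f i + sum (λ k → f (punchIn i k))  ≡⟨ sum-remove {i = i} f ⟨
  sum f                                       ∎
  where open ℤP.≤-Reasoning

nonpos-family : ∀ {m} {f : Fin m → ℤ} → (∀ i → f i ≤ 0ℤ) → 0ℤ ≤ sum f → ∀ i → 0ℤ ≤ f i
nonpos-family {f = f} f≤0 0≤∑f i = ℤP.neg-cancel-≤ (ℤP.≤-trans -fᵢ≤-∑f (ℤP.neg-mono-≤ 0≤∑f))
  where
  -fᵢ≤-∑f : - f i ≤ - sum f
  -fᵢ≤-∑f = subst (- f i ≤_) (sum-neg f) (term≤sum (λ k → ℤP.neg-mono-≤ (f≤0 k)) i)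

sum-single : ∀ {m} {f : Fin m → ℤ} (i : Fin m) → (∀ l → l ≢ i → f l ≡ 0ℤ) → sum f ≡ f i
sum-single {suc m} {f} i others = begin
  sum f                              ≡⟨ sum-remove {i = i} f ⟩
  f i + sum (λ k → f (punchIn i k))  ≡⟨ cong (λ t → f i + t) (sum-cong-≗ (λ k → others _ (punchInᵢ≢i i k))) ⟩
  f i + sum {m} (λ _ → 0ℤ)           ≡⟨ cong (λ t → f i + t) (sum-replicate-zero m) ⟩
  f i + 0ℤ                           ≡⟨ ℤP.+-identityʳ (f i) ⟩
  f i                                ∎
  where open ≡-Reasoning

if-diag : ∀ {A : Set} {m} (i : Fin m) {x y : A} → (if ⌊ i ≟ i ⌋ then x else y) ≡ x
if-diag i with i ≟ i
... | yes _   = refl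
... | no i≢i = ⊥-elim (i≢i refl)

if-off : ∀ {A : Set} {m} {i j : Fin m} {x y : A} → i ≢ j → (if ⌊ i ≟ j ⌋ then x else y) ≡ y
if-off {i = i} {j} i≢j with i ≟ j
... | yes i≡j = ⊥-elim (i≢j i≡j)
... | no _    = refl

+≡⇒≡- : ∀ {a b c} → a + b ≡ c → a ≡ c - b
+≡⇒≡- {a} {b} refl = cancel a b
  where
  cancel : ∀ a b → a ≡ (a + b) - b
  cancel = solve-∀

sub-swap : ∀ {a b c} → a ≡ b - c → c ≡ b - a
sub-swap {b = b} {c} refl = cancel b c
  where
  cancel : ∀ b c → c ≡ b - (b - c)
  cancel = solve-∀

≤-sub-nonpos : ∀ x {y} → y ≤ 0ℤ → x ≤ x - y
≤-sub-nonpos x {y} y≤0 =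
  subst (_≤ x - y) (ℤP.+-identityʳ x) (ℤP.+-monoʳ-≤ x (ℤP.neg-mono-≤ y≤0))

sub-nonneg≤ : ∀ x {y} → 0ℤ ≤ y → x - y ≤ x
sub-nonneg≤ x {y} 0≤y = ℤP.i-j≤i x y {{nonNegative 0≤y}}

posPart negPart : ℤ → ℤ
posPart (+ m)     = + m
posPart -[1+ _ ]  = 0ℤ
negPart (+ _)     = 0ℤ
negPart -[1+ k ]  = + suc k

parts : ∀ z → z ≡ posPart z - negPart z
parts (+ m)     = sym (ℤP.+-identityʳ (+ m))
parts -[1+ k ]  = sym (ℤP.+-identityˡ -[1+ k ])

parts-disjoint : ∀ z → negPart z ≡ 0ℤ ⊎ posPart z ≡ 0ℤ
parts-disjoint (+ _)     = inj₁ refl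
parts-disjoint -[1+ _ ]  = inj₂ refl

posPart≥0 : ∀ z → 0ℤ ≤ posPart z
posPart≥0 (+ _)     = +≤+ Nat.z≤n
posPart≥0 -[1+ _ ]  = ℤP.≤-refl

negPart≥0 : ∀ z → 0ℤ ≤ negPart z
negPart≥0 (+ _)     = ℤP.≤-refl
negPart≥0 -[1+ _ ]  = +≤+ Nat.z≤n

nonneg-or-negPart-pos : ∀ z → 0ℤ ≤ z ⊎ 0ℤ < negPart z
nonneg-or-negPart-pos (+ _)     = inj₁ (+≤+ Nat.z≤n)
nonneg-or-negPart-pos -[1+ _ ]  = inj₂ (+<+ (Nat.s≤s Nat.z≤n))

module Laplacian {n : ℕ} (G : Multigraph n) where

  edges : Fin n → Fin n → ℕ
  edges i j = G (vtx G i) (vtx G j)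

  off : Fin n → Fin n → ℤ
  off i j = if ⌊ i ≟ j ⌋ then 0ℤ else + edges i j

  off≥0 : ∀ i j → 0ℤ ≤ off i j
  off≥0 i j with ⌊ i ≟ j ⌋
  ... | true  = ℤP.≤-refl
  ... | false = +≤+ Nat.z≤n

  off≤edges : ∀ i j → off i j ≤ + edges i j
  off≤edges i j with ⌊ i ≟ j ⌋
  ... | true  = +≤+ Nat.z≤n
  ... | false = ℤP.≤-refl

  Δ+off-diag : ∀ i → Δ G i i + off i i ≡ d⁺ G i
  Δ+off-diag i = trans (cong₂ _+_ (if-diag i) (if-diag i)) (ℤP.+-identityʳ (d⁺ G i))

  Δ+off-off : ∀ {i j} → i ≢ j → Δ G i j + off i j ≡ 0ℤ
  Δ+off-off {i} {j} i≢j = trans (cong₂ _+_ (if-off i≢j) (if-off i≢j)) (ℤP.+-inverseˡ (+ edges i j))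

  rowSum : Fin n → ℤ
  rowSum i = sum (Δ G i)

  -- Only the diagonal survives in Σⱼ (Δᵢⱼ + off i j).
  rowSum≡ : ∀ i → rowSum i ≡ d⁺ G i - sum (off i)
  rowSum≡ i = +≡⇒≡- (begin
    sum (Δ G i) + sum (off i)           ≡⟨ ∑-distrib-+ (Δ G i) (off i) ⟨
    sum (λ j → Δ G i j + off i j)       ≡⟨ sum-single i (λ j j≢i → Δ+off-off (≢-sym j≢i)) ⟩
    Δ G i i + off i i                   ≡⟨ Δ+off-diag i ⟩
    d⁺ G i                              ∎)
    where open ≡-Reasoning

  d⁺-split : ∀ i → d⁺ G i ≡ sum (λ j → + edges i j) + + G (vtx G i) (sink G)
  d⁺-split i = trans (sumℕ≡sum (G (vtx G i))) (sum-init-last (λ j → + G (vtx G i) j))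

  sink-edges≤rowSum : ∀ i → + G (vtx G i) (sink G) ≤ rowSum i
  sink-edges≤rowSum i = begin
    s                   ≡⟨ cancel E s ⟩
    (E + s) - E         ≤⟨ ℤP.+-monoʳ-≤ (E + s) (ℤP.neg-mono-≤ (sum-mono (off≤edges i))) ⟩
    (E + s) - sum (off i) ≡⟨ cong (_- sum (off i)) (d⁺-split i) ⟨
    d⁺ G i - sum (off i)  ≡⟨ rowSum≡ i ⟨
    rowSum i            ∎
    where
    open ℤP.≤-Reasoning
    E = sum (λ j → + edges i j)
    s = + G (vtx G i) (sink G)
    cancel : ∀ E s → s ≡ (E + s) - E
    cancel = solve-∀

  rowSum≥0 : ∀ i → 0ℤ ≤ rowSum i
  rowSum≥0 i = ℤP.≤-trans (+≤+ Nat.z≤n) (sink-edges≤rowSum i)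

  -- lost v j: the chips j loses when every vertex i fires v i times.
  lost : (Fin n → ℤ) → Config G
  lost v j = sum (λ i → v i * Δ G i j)

  lost-+ : ∀ u v j → lost (λ i → u i + v i) j ≡ lost u j + lost v j
  lost-+ u v j = trans (sum-cong-≗ (λ i → ℤP.*-distribʳ-+ (Δ G i j) (u i) (v i)))
                       (∑-distrib-+ (λ i → u i * Δ G i j) (λ i → v i * Δ G i j))

  lost-neg : ∀ v j → lost (λ i → - v i) j ≡ - lost v j
  lost-neg v j = trans (sum-cong-≗ (λ i → sym (ℤP.neg-distribˡ-* (v i) (Δ G i j))))
                       (sum-neg (λ i → v i * Δ G i j))

  lost-column : ∀ v j → lost v j ≡ v j * d⁺ G j - sum (λ i → v i * off i j)
  lost-column v j = +≡⇒≡- (begin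
    lost v j + sum (λ i → v i * off i j)   ≡⟨ ∑-distrib-+ (λ i → v i * Δ G i j) (λ i → v i * off i j) ⟨
    sum (λ i → v i * Δ G i j + v i * off i j) ≡⟨ sum-cong-≗ (λ i → ℤP.*-distribˡ-+ (v i) (Δ G i j) (off i j)) ⟨
    sum (λ i → v i * (Δ G i j + off i j))  ≡⟨ sum-single j (λ i i≢j → trans (cong (v i *_) (Δ+off-off i≢j)) (ℤP.*-zeroʳ (v i))) ⟩
    v j * (Δ G j j + off j j)              ≡⟨ cong (v j *_) (Δ+off-diag j) ⟩
    v j * d⁺ G j                           ∎)
    where open ≡-Reasoning

  lost≤diag : ∀ {v} → NonNeg G v → ∀ j → lost v j ≤ v j * d⁺ G j
  lost≤diag {v} v≥0 j = subst (_≤ v j * d⁺ G j) (sym (lost-column v j))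
    (sub-nonneg≤ (v j * d⁺ G j) (sum-nonneg (λ i → *-nonneg (v≥0 i) (off≥0 i j))))

  lost-at-idle : ∀ {v} → NonNeg G v → ∀ {j} → v j ≡ 0ℤ → lost v j ≤ 0ℤ
  lost-at-idle {v} v≥0 {j} vⱼ≡0 = subst (λ x → lost v j ≤ x * d⁺ G j) vⱼ≡0 (lost≤diag v≥0 j)

  sum-lost : ∀ v → sum (lost v) ≡ sum (λ i → v i * rowSum i)
  sum-lost v = trans (sym (∑-comm (λ i j → v i * Δ G i j)))
                     (sum-cong-≗ (λ i → sym (*-distribˡ-sum (v i) (Δ G i))))

  sum-lost≥0 : ∀ {v} → NonNeg G v → 0ℤ ≤ sum (lost v)
  sum-lost≥0 {v} v≥0 = subst (0ℤ ≤_) (sym (sum-lost v))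
    (sum-nonneg (λ i → *-nonneg (v≥0 i) (rowSum≥0 i)))

  unit : Fin n → Fin n → ℤ
  unit i l = if ⌊ i ≟ l ⌋ then 1ℤ else 0ℤ

  lost-unit : ∀ i j → lost (unit i) j ≡ Δ G i j
  lost-unit i j = begin
    lost (unit i) j     ≡⟨ sum-single i (λ l l≢i → cong (_* Δ G l j) (if-off (≢-sym l≢i))) ⟩
    unit i i * Δ G i j  ≡⟨ cong (_* Δ G i j) (if-diag i) ⟩
    1ℤ * Δ G i j        ≡⟨ ℤP.*-identityˡ (Δ G i j) ⟩
    Δ G i j             ∎
    where open ≡-Reasoning

  -- X ─[ v ]→ b: firing every i exactly v i times (in any order, ignoring
  -- whether vertices are active) turns X into b.
  _─[_]→_ : Config G → (Fin n → ℤ) → Config G → Set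
  X ─[ v ]→ b = ∀ j → b j ≡ X j - lost v j

  unfire : ∀ {X v b} i → fire G X i ─[ v ]→ b → X ─[ (λ l → v l + unit i l) ]→ b
  unfire {X} {v} {b} i Xᵢ→b j = begin
    b j                               ≡⟨ Xᵢ→b j ⟩
    (X j - Δ G i j) - lost v j        ≡⟨ regroup (X j) (Δ G i j) (lost v j) ⟩
    X j - (lost v j + Δ G i j)        ≡⟨ cong (λ t → X j - (lost v j + t)) (lost-unit i j) ⟨
    X j - (lost v j + lost (unit i) j) ≡⟨ cong (λ t → X j - t) (lost-+ v (unit i) j) ⟨
    X j - lost (λ l → v l + unit i l) j ∎
    where
    open ≡-Reasoning
    regroup : ∀ x d l → (x - d) - l ≡ x - (l + d)
    regroup = solve-∀

  refire : ∀ {X v b} i → X ─[ v ]→ b → fire G X i ─[ (λ l → v l - unit i l) ]→ b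
  refire {X} {v} {b} i X→b j = begin
    b j                               ≡⟨ X→b j ⟩
    X j - lost v j                    ≡⟨ regroup (X j) (Δ G i j) (lost v j) ⟩
    (X j - Δ G i j) - (lost v j - Δ G i j) ≡⟨ cong (λ t → (X j - Δ G i j) - (lost v j - t)) (lost-unit i j) ⟨
    (X j - Δ G i j) - (lost v j - lost (unit i) j) ≡⟨ cong (λ t → (X j - Δ G i j) - (lost v j + t)) (lost-neg (unit i) j) ⟨
    (X j - Δ G i j) - (lost v j + lost (λ l → - unit i l) j) ≡⟨ cong (λ t → (X j - Δ G i j) - t) (lost-+ v (λ l → - unit i l) j) ⟨
    (X j - Δ G i j) - lost (λ l → v l - unit i l) j ∎
    where
    open ≡-Reasoning
    regroup : ∀ x d l → x - l ≡ (x - d) - (l - d)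
    regroup = solve-∀

  pullback : ∀ {X Y v b} → _⟶*_ G X Y → Y ─[ v ]→ b → ∃ λ w → X ─[ w ]→ b
  pullback {v = v} done Y→b = v , Y→b
  pullback {X} {v = v} (step i _ rest) Y→b with pullback {v = v} rest Y→b
  ... | w , Xᵢ→b = (λ l → w l + unit i l) , unfire {X} {w} i Xᵢ→b

  -- A non-negative script from X to a b with i not active in b fires every
  -- vertex i active in X; otherwise i could only gain chips.
  active-fires : ∀ {X w b} i → NonNeg G w → X ─[ w ]→ b →
                 Active G X i → b i < d⁺ G i → 0ℤ < w i
  active-fires {X} {w} {b} i w≥0 X→b active bᵢ<d with 0ℤ ℤP.<? w i
  ... | yes 0<wᵢ = 0<wᵢ
  ... | no ¬0<wᵢ = ⊥-elim (ℤP.<⇒≱ bᵢ<d d≤bᵢ)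
    where
    wᵢ≡0 : w i ≡ 0ℤ
    wᵢ≡0 = ℤP.≤-antisym (ℤP.≮⇒≥ ¬0<wᵢ) (w≥0 i)
    d≤bᵢ : d⁺ G i ≤ b i
    d≤bᵢ = ℤP.≤-trans active (subst (X i ≤_) (sym (X→b i))
             (≤-sub-nonpos (X i) (lost-at-idle w≥0 wᵢ≡0)))

  remove-firing-nonneg : ∀ {w} i → NonNeg G w → 0ℤ < w i → NonNeg G (λ l → w l - unit i l)
  remove-firing-nonneg {w} i w≥0 0<wᵢ l with i ≟ l
  ... | yes refl = ℤP.i≤j⇒0≤j-i (ℤP.i<j⇒suc[i]≤j 0<wᵢ)
  ... | no _     = subst (0ℤ ≤_) (sym (ℤP.+-identityʳ (w l))) (w≥0 l)

  pushforward : ∀ {X Y w b} → _⟶*_ G X Y → Stable G b → NonNeg G w → X ─[ w ]→ b →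
                ∃ λ w′ → NonNeg G w′ × Y ─[ w′ ]→ b
  pushforward {w = w} done _ w≥0 X→b = w , w≥0 , X→b
  pushforward {X} {w = w} (step i active rest) b-stable w≥0 X→b =
    pushforward rest b-stable (remove-firing-nonneg i w≥0 0<wᵢ) (refire {X} {w} i X→b)
    where
    0<wᵢ : 0ℤ < w i
    0<wᵢ = active-fires {X} {w} i w≥0 X→b active (proj₂ (b-stable i))

  weight-decreases : ∀ {X v b} → NonNeg G v → X ─[ v ]→ b → weight G b ≤ weight G X
  weight-decreases {X} {v} {b} v≥0 X→b = begin
    weight G b                    ≡⟨ sumℤ≡sum b ⟩
    sum b                         ≡⟨ sum-cong-≗ X→b ⟩
    sum (λ j → X j - lost v j)    ≡⟨ sum-sub X (lost v) ⟩
    sum X - sum (lost v)          ≤⟨ sub-nonneg≤ (sum X) (sum-lost≥0 v≥0) ⟩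
    sum X                         ≡⟨ sumℤ≡sum X ⟨
    weight G X                    ∎
    where open ℤP.≤-Reasoning

  path-closed : (P : Fin (suc n) → Set) → (∀ {u u'} → P u → 0 Nat.< G u u' → P u') →
                ∀ {u v} → Path G u v → P u → P v
  path-closed P closed here          Pu = Pu
  path-closed P closed (edge e rest) Pu = path-closed P closed rest (closed Pu e)

  -- A non-negative script under which no vertex loses chips has a support
  -- with no edge leaving it; with a global sink the script is therefore zero.
  module Superharmonic {v : Fin n → ℤ} (v≥0 : NonNeg G v) (lost≤0 : ∀ j → lost v j ≤ 0ℤ) where

    -- The total loss is ≤ 0, while it is Σᵢ vᵢ ρᵢ ≥ 0.
    total≤0 : sum (lost v) ≤ 0ℤ
    total≤0 = subst (sum (lost v) ≤_) (sum-replicate-zero n) (sum-mono lost≤0)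

    -- So vₓ ρₓ ≤ 0 for every x, and ρₓ bounds the edges from x to the sink.
    no-sink-edge : ∀ x → 0ℤ < v x → ¬ (0 Nat.< G (vtx G x) (sink G))
    no-sink-edge x 0<vₓ = not-positive (ℤP.≤-trans (sink-edges≤rowSum x) (pos-factor-nonpos 0<vₓ vₓρₓ≤0))
      where
      vₓρₓ≤0 : v x * rowSum x ≤ 0ℤ
      vₓρₓ≤0 = ℤP.≤-trans (term≤sum (λ i → *-nonneg (v≥0 i) (rowSum≥0 i)) x)
                          (subst (_≤ 0ℤ) (sum-lost v) total≤0)

    -- Every lost v j is then 0; for vⱼ = 0 this says j receives no chips,
    -- so no edge enters j from the support.
    no-edge-out : ∀ x j → 0ℤ < v x → v j ≡ 0ℤ → ¬ (0 Nat.< edges x j)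
    no-edge-out x j 0<vₓ vⱼ≡0 = not-positive (pos-factor-nonpos 0<vₓ vₓeₓⱼ≤0)
      where
      x≢j : x ≢ j
      x≢j refl = ℤP.<-irrefl (sym vⱼ≡0) 0<vₓ
      received : Fin n → ℤ
      received i = v i * off i j
      received≤0 : sum received ≤ 0ℤ
      received≤0 = ℤP.neg-cancel-≤ (subst (0ℤ ≤_) eq (nonpos-family lost≤0 (sum-lost≥0 v≥0) j))
        where
        eq : lost v j ≡ - sum received
        eq = trans (lost-column v j)
               (trans (cong (λ t → t * d⁺ G j - sum received) vⱼ≡0) (ℤP.+-identityˡ _))
      vₓeₓⱼ≤0 : v x * + edges x j ≤ 0ℤ
      vₓeₓⱼ≤0 = subst (λ t → v x * t ≤ 0ℤ) (if-off x≢j)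
                  (ℤP.≤-trans (term≤sum (λ i → *-nonneg (v≥0 i) (off≥0 i j)) x) received≤0)

    Support : Fin (suc n) → Set
    Support u = ∃ λ x → u ≡ vtx G x × 0ℤ < v x

    support-closed : ∀ {u u'} → Support u → 0 Nat.< G u u' → Support u'
    support-closed {u' = u'} (x , refl , 0<vₓ) e with view u'
    ... | ‵fromℕ = ⊥-elim (no-sink-edge x 0<vₓ e)
    ... | ‵inj₁ {i = j} _ with 0ℤ ℤP.<? v j
    ...   | yes 0<vⱼ = j , refl , 0<vⱼ
    ...   | no ¬0<vⱼ = ⊥-elim (no-edge-out x j 0<vₓ (ℤP.≤-antisym (ℤP.≮⇒≥ ¬0<vⱼ) (v≥0 j)) e)

    vanishes : GlobalSink G → ∀ x → ¬ (0ℤ < v x)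
    vanishes (_ , reach) x 0<vₓ with path-closed Support support-closed (reach (vtx G x)) (x , refl , 0<vₓ)
    ... | y , sink≡y , _ = fromℕ≢inject₁ sink≡y

  -- Monotonicity of Δ: a script under which no vertex gains chips is
  -- non-negative, since its negative part p satisfies lost p ≤ 0 and vanishes.
  lost≥0⇒nonneg : GlobalSink G → ∀ {w} → (∀ j → 0ℤ ≤ lost w j) → NonNeg G w
  lost≥0⇒nonneg sinks {w} 0≤lost i with nonneg-or-negPart-pos (w i)
  ... | inj₁ 0≤wᵢ = 0≤wᵢ
  ... | inj₂ 0<pᵢ = ⊥-elim (Superharmonic.vanishes p≥0 lost-p≤0 sinks i 0<pᵢ)
    where
    p q : Fin n → ℤ
    p l = negPart (w l)
    q l = posPart (w l)
    p≥0 : NonNeg G p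
    p≥0 l = negPart≥0 (w l)
    lost-w : ∀ j → lost w j ≡ lost q j - lost p j
    lost-w j = begin
      lost w j                         ≡⟨ sum-cong-≗ (λ l → cong (_* Δ G l j) (parts (w l))) ⟩
      lost (λ l → q l - p l) j         ≡⟨ lost-+ q (λ l → - p l) j ⟩
      lost q j + lost (λ l → - p l) j  ≡⟨ cong (λ t → lost q j + t) (lost-neg p j) ⟩
      lost q j - lost p j              ∎
      where open ≡-Reasoning
    lost-p≤0 : ∀ j → lost p j ≤ 0ℤ
    lost-p≤0 j with parts-disjoint (w j)
    ... | inj₁ pⱼ≡0 = lost-at-idle p≥0 pⱼ≡0
    ... | inj₂ qⱼ≡0 = begin
      lost p j             ≡⟨ sub-swap {b = lost q j} (lost-w j) ⟩
      lost q j - lost w j  ≤⟨ sub-nonneg≤ (lost q j) (0≤lost j) ⟩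
      lost q j             ≤⟨ lost-at-idle (λ l → posPart≥0 (w l)) qⱼ≡0 ⟩
      0ℤ                   ∎
      where open ℤP.≤-Reasoning

  ∼⇒script : ∀ {a b} → _∼_ G b a → ∃ λ k → a ─[ k ]→ b
  ∼⇒script {a} {b} (k , b-a≡kΔ) = (λ i → - k i) , a→b
    where
    a→b : a ─[ (λ i → - k i) ]→ b
    a→b j = begin
      b j                            ≡⟨ regroup (a j) (b j) ⟩
      a j - - (b j - a j)            ≡⟨ cong (λ t → a j - - t) (trans (b-a≡kΔ j) (sumℤ≡sum (λ i → k i * Δ G i j))) ⟩
      a j - - lost k j               ≡⟨ cong (λ t → a j - t) (lost-neg k j) ⟨
      a j - lost (λ i → - k i) j     ∎
      where
      open ≡-Reasoning
      regroup : ∀ a b → b ≡ a - - (b - a)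
      regroup = solve-∀

  below⇒lost≥0 : ∀ {X w b} → X ─[ w ]→ b → (∀ j → b j ≤ X j) → ∀ j → 0ℤ ≤ lost w j
  below⇒lost≥0 {X} {w} {b} X→b b≤X j =
    subst (0ℤ ≤_) (sym (sub-swap {b = X j} (X→b j))) (ℤP.i≤j⇒0≤j-i (b≤X j))

  stable≤amax : ∀ {b} → Stable G b → ∀ j → b j ≤ amax G j
  stable≤amax {b} b-stable j =
    subst (b j ≤_) (ℤP.+-comm -1ℤ (d⁺ G j)) (ℤP.i<j⇒i≤pred[j] (proj₂ (b-stable j)))

theorem3p9 : (n : ℕ) → 1 Data.Nat.≤ n → (G : Multigraph n) → GlobalSink G →
    (a b : Config G) → Critical G a → Stable G b → _∼_ G b a →
    weight G b ≤ weight G a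
theorem3p9 n _ G sinks a b (_ , c , c≥0 , X⟶*a , _) b-stable b∼a =
  weight-decreases (proj₁ (proj₂ pushed)) (proj₂ (proj₂ pushed))
  where
  open Laplacian G
  -- a is the stabilization of X = amax + c, which lies above b.
  X : Config G
  X i = amax G i + c i
  b≤X : ∀ j → b j ≤ X j
  b≤X j = ℤP.≤-trans (stable≤amax b-stable j) (ℤP.i≤i+j (amax G j) (c j) {{nonNegative (c≥0 j)}})
  -- A script from a to b pulls back to one from X; it is non-negative since b ≤ X.
  pulled : ∃ λ w → X ─[ w ]→ b
  pulled = pullback {v = proj₁ a→b} X⟶*a (proj₂ a→b)
    where a→b = ∼⇒script {a} {b} b∼a
  pulled≥0 : NonNeg G (proj₁ pulled)
  pulled≥0 = lost≥0⇒nonneg sinks (below⇒lost≥0 {X} {proj₁ pulled} (proj₂ pulled) b≤X)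
  pushed : ∃ λ w′ → NonNeg G w′ × a ─[ w′ ]→ b
  pushed = pushforward X⟶*a b-stable pulled≥0 (proj₂ pulled)
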